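{- Let $t_n=(-1)^{s_2(n)}$, $h_0=0$, $h_1=1$, and $h_n=t_nh_{n-1}+h_{n-2}$ for $n\ge2$. For every integer $m\ge 2$, the sequence $(h_n \bmod m)_{n\in\mathbb{N}}$ (with values in $\{0,\ldots,m-1\}$) is $2$-automatic.
   Context: $s_2(n)$ denotes the number of 1's in the binary expansion of $n$; $(t_n)$ is the Prouhet–Thue–Morse sequence. A sequence $(a_n)_{n\in\mathbb{N}}$ with values in a finite set $\Delta$ is $k$-automatic if there is a deterministic finite automaton with output (finite state set $Q$, input alphabet $\{0,\ldots,k-1\}$, transition function $\delta:Q\times\{0,\ldots,k-1\}\to Q$, initial state $q_0$, output map $\tau:Q\to\Delta$) such that $a_n=\tau(\hat\delta(q_0,w))$ where $w$ is the base-$k$ representation of $n$ read from the most significant digit; equivalently, the $k$-kernel $\{(a_{k^in+j})_{n}: i\in\mathbb{N}, 0\le j<k^i\}$ is finite. -}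

module Defs where

open import Data.Nat as ℕ using (ℕ; zero; suc; NonZero)
open import Data.Nat.DivMod as NDM using ()
open import Data.Integer as ℤ using (ℤ; +_)
open import Data.Integer.DivMod as ZDM using ()
open import Data.Fin using (Fin; zero; suc)
open import Data.List using (List; []; _∷_; _∷ʳ_; foldl)
open import Data.Product using (Σ; ∃; _,_)
open import Relation.Binary.PropositionalEquality using (_≡_)

-- Base-2 digits of n, least significant digit first, computed with fuel.
-- The canonical representation: no leading zeros, and 0 ↦ empty word.
bitsLSBAux : ℕ → ℕ → List (Fin 2)
bitsLSBAux zero    _ = []
bitsLSBAux (suc f) zero = []
bitsLSBAux (suc f) (suc n) = NDM._mod_ (suc n) 2 ∷ bitsLSBAux f (suc n NDM./ 2)

bitsLSB : ℕ → List (Fin 2)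
bitsLSB n = bitsLSBAux n n

rev : {A : Set} → List A → List A
rev []       = []
rev (x ∷ xs) = rev xs ∷ʳ x

base2 : ℕ → List (Fin 2)
base2 n = rev (bitsLSB n)

s₂ : ℕ → ℕ
s₂ n = count (bitsLSB n)
  where
  count : List (Fin 2) → ℕ
  count []             = 0
  count (zero ∷ xs)    = count xs
  count (suc _ ∷ xs)   = suc (count xs)

signPow : ℕ → ℤ
signPow zero    = ℤ.+ 1
signPow (suc k) = ℤ.- signPow k

t : ℕ → ℤ
t n = signPow (s₂ n)

h : ℕ → ℤ
h zero          = + 0
h (suc zero)    = + 1
h (suc (suc n)) = t (suc (suc n)) ℤ.* h (suc n) ℤ.+ h n

hmod : (m : ℕ) → .{{_ : NonZero m}} → ℕ → Fin m
hmod m n = Data.Fin.fromℕ< (ZDM.n%d<d (h n) (+ m))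
  where import Data.Fin

record DFAO (k : ℕ) (Δ : Set) : Set where
  field
    nStates : ℕ
    δ       : Fin nStates → Fin k → Fin nStates
    q₀      : Fin nStates
    τ       : Fin nStates → Δ

  δ̂ : Fin nStates → List (Fin k) → Fin nStates
  δ̂ = foldl δ

Is2Automatic : {Δ : Set} → (ℕ → Δ) → Set
Is2Automatic {Δ} a = Σ (DFAO 2 Δ) λ A → ∀ n → a n ≡ DFAO.τ A (DFAO.δ̂ A (DFAO.q₀ A) (base2 n))

-- Write τ n ∈ {0,1} for the Thue–Morse bit, so t n = (-1)^(τ n). The recurrence reads
-- (h n , h (n-1)) = H(t n) · (h (n-1) , h (n-2)) with H(z) = [[z,1],[1,0]], so h n is a coordinate of
-- X_{τ n} ⋯ X_{τ 0} · v for the pair X = (H 1, H (-1)). Since τ(2k) = τ k and τ(2k+1) = 1 - τ k, the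
-- product of length 2N over X is the product of length N over μ X = (X₁X₀, X₀X₁), and length 2N+1 adds
-- the factor X_{τ N}. Hence τ N together with the products of length N, taken mod m for every pair X of
-- matrices mod m, determines the same data for 2N and 2N+1. There are finitely many such data, so
-- reading the binary digits of N from the top is a finite automaton.

module Submission where

open import Defs
open import Data.Nat as ℕ using (ℕ; zero; suc; NonZero; _≤_; _<_; _≥_; _^_; z≤n; s≤s)
import Data.Nat.Properties as ℕ
open import Data.Nat.DivMod using (_/_; _%_; _mod_; m≡m%n+[m/n]*n; [m+kn]%n≡m%n; m<n⇒m%n≡m;
  +-distrib-/-∣ʳ; m<n⇒m/n≡0; m*n/n≡m; m/n<m)
open import Data.Nat.Divisibility using (divides-refl; >⇒∤) renaming (_∣_ to _∣ℕ_)
open import Data.Integer as ℤ using (ℤ; +_; -_; _+_; _*_; _-_)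
import Data.Integer.Properties as ℤ
open import Data.Integer.DivMod using (n%d<d; a≡a%n+[a/n]*n)
open import Data.Integer.Divisibility.Signed
  using (_∣_; divides; ∣m∣n⇒∣m+n; ∣m⇒∣-m; ∣n⇒∣m*n; ∣m⇒∣m*n; ∣⇒∣ᵤ)
open import Data.Integer.Tactic.RingSolver using (solve-∀)
open import Data.Fin using (Fin; zero; suc; toℕ; fromℕ<; combine; remQuot; funToFin; finToFun)
open import Data.Fin.Properties
  using (toℕ-fromℕ<; toℕ-injective; toℕ<n; remQuot-combine; finToFun-funToFin)
open import Data.List using (List; []; _∷_; foldl; foldr)
open import Data.List.Properties using (foldl-∷ʳ)
open import Data.Product using (_×_; _,_; proj₁; proj₂; map)
open import Data.Product.Relation.Binary.Pointwise.NonDependent using (Pointwise; ×-setoid)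
open import Function using (_∘_; id)
open import Level using (0ℓ)
open import Relation.Binary using (Rel; Reflexive; Symmetric; Transitive; Setoid)
import Relation.Binary.Reasoning.Setoid as SetoidReasoning
open import Relation.Binary.PropositionalEquality
open import Relation.Nullary using (contradiction)

pushBit : ℕ → Fin 2 → ℕ
pushBit n b = toℕ b ℕ.+ n ℕ.* 2

pushBit-mod : ∀ n b → pushBit n b mod 2 ≡ b
pushBit-mod n b = toℕ-injective (begin
  toℕ (pushBit n b mod 2)  ≡⟨ toℕ-fromℕ< _ ⟩
  (toℕ b ℕ.+ n ℕ.* 2) % 2  ≡⟨ [m+kn]%n≡m%n (toℕ b) n 2 ⟩
  toℕ b % 2                ≡⟨ m<n⇒m%n≡m (toℕ<n b) ⟩
  toℕ b                    ∎)
  where open ≡-Reasoning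

pushBit-div : ∀ n b → pushBit n b / 2 ≡ n
pushBit-div n b = begin
  (toℕ b ℕ.+ n ℕ.* 2) / 2    ≡⟨ +-distrib-/-∣ʳ (toℕ b) (divides-refl n) ⟩
  toℕ b / 2 ℕ.+ n ℕ.* 2 / 2  ≡⟨ cong₂ ℕ._+_ (m<n⇒m/n≡0 (toℕ<n b)) (m*n/n≡m n 2) ⟩
  n                          ∎
  where open ≡-Reasoning

pushBit-mod-div : ∀ n → pushBit (n / 2) (n mod 2) ≡ n
pushBit-mod-div n = trans (cong (ℕ._+ n / 2 ℕ.* 2) (toℕ-fromℕ< _)) (sym (m≡m%n+[m/n]*n n 2))

[1+n]/2≤n : ∀ n → suc n / 2 ≤ n
[1+n]/2≤n n = ℕ.≤-pred (m/n<m (suc n) 2 (s≤s (s≤s z≤n)))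

bitsLSBAux-fuel : ∀ f g n → n ≤ f → n ≤ g → bitsLSBAux f n ≡ bitsLSBAux g n
bitsLSBAux-fuel zero    zero    zero    _         _         = refl
bitsLSBAux-fuel zero    (suc g) zero    _         _         = refl
bitsLSBAux-fuel (suc f) zero    zero    _         _         = refl
bitsLSBAux-fuel (suc f) (suc g) zero    _         _         = refl
bitsLSBAux-fuel (suc f) (suc g) (suc n) (s≤s n≤f) (s≤s n≤g) =
  cong (_ ∷_) (bitsLSBAux-fuel f g (suc n / 2)
    (ℕ.≤-trans ([1+n]/2≤n n) n≤f) (ℕ.≤-trans ([1+n]/2≤n n) n≤g))

bitsLSBAux≡bitsLSB : ∀ f n → n ≤ f → bitsLSBAux f n ≡ bitsLSB n
bitsLSBAux≡bitsLSB f n n≤f = bitsLSBAux-fuel f n n n≤f ℕ.≤-refl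

s₂-even : ∀ n → s₂ (n ℕ.* 2) ≡ s₂ n
s₂-even zero = refl
s₂-even (suc n)
  rewrite pushBit-mod (suc n) zero | pushBit-div (suc n) zero
        | bitsLSBAux≡bitsLSB (suc (n ℕ.* 2)) (suc n) (s≤s (ℕ.m≤m*n n 2)) = refl

s₂-odd : ∀ n → s₂ (suc (n ℕ.* 2)) ≡ suc (s₂ n)
s₂-odd n
  rewrite pushBit-mod n (suc zero) | pushBit-div n (suc zero)
        | bitsLSBAux≡bitsLSB (n ℕ.* 2) n (ℕ.m≤m*n n 2) = refl

valueLSB : List (Fin 2) → ℕ
valueLSB = foldr (λ b n → pushBit n b) 0

valueLSB-bitsLSBAux : ∀ f n → n ≤ f → valueLSB (bitsLSBAux f n) ≡ n
valueLSB-bitsLSBAux zero    zero    _         = refl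
valueLSB-bitsLSBAux (suc f) zero    _         = refl
valueLSB-bitsLSBAux (suc f) (suc n) (s≤s n≤f) = begin
  pushBit (valueLSB (bitsLSBAux f (suc n / 2))) (suc n mod 2)
    ≡⟨ cong (λ k → pushBit k (suc n mod 2))
         (valueLSB-bitsLSBAux f (suc n / 2) (ℕ.≤-trans ([1+n]/2≤n n) n≤f)) ⟩
  pushBit (suc n / 2) (suc n mod 2)
    ≡⟨ pushBit-mod-div (suc n) ⟩
  suc n ∎
  where open ≡-Reasoning

foldl-pushBit-rev : ∀ bs → foldl pushBit 0 (rev bs) ≡ valueLSB bs
foldl-pushBit-rev []       = refl
foldl-pushBit-rev (b ∷ bs) =
  trans (foldl-∷ʳ pushBit 0 b (rev bs)) (cong (λ n → pushBit n b) (foldl-pushBit-rev bs))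

foldl-pushBit-base2 : ∀ n → foldl pushBit 0 (base2 n) ≡ n
foldl-pushBit-base2 n = trans (foldl-pushBit-rev (bitsLSB n)) (valueLSB-bitsLSBAux n n ℕ.≤-refl)

-- The Thue–Morse sequence

flipBit : Fin 2 → Fin 2
flipBit zero       = suc zero
flipBit (suc zero) = zero

parity : ℕ → Fin 2
parity zero    = zero
parity (suc k) = flipBit (parity k)

tmBit : ℕ → Fin 2
tmBit n = parity (s₂ n)

tmBit-even : ∀ n → tmBit (n ℕ.* 2) ≡ tmBit n
tmBit-even n = cong parity (s₂-even n)

tmBit-odd : ∀ n → tmBit (suc (n ℕ.* 2)) ≡ flipBit (tmBit n)
tmBit-odd n = cong parity (s₂-odd n)

sign : Fin 2 → ℤ
sign zero       = + 1
sign (suc zero) = - + 1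

signPow≡sign∘parity : ∀ k → signPow k ≡ sign (parity k)
signPow≡sign∘parity zero    = refl
signPow≡sign∘parity (suc k) = trans (cong -_ (signPow≡sign∘parity k)) (-sign (parity k))
  where
  -sign : ∀ p → - sign p ≡ sign (flipBit p)
  -sign zero       = refl
  -sign (suc zero) = refl

t≡sign∘tmBit : ∀ n → t n ≡ sign (tmBit n)
t≡sign∘tmBit n = signPow≡sign∘parity (s₂ n)

-- Products along the Thue–Morse word

module ThueMorseProduct {M V : Set} (_·_ : M → V → V) (_⊙_ : M → M → M)
                        (·-⊙ : ∀ A B v → (A ⊙ B) · v ≡ A · (B · v)) where

  select : M × M → Fin 2 → M
  select (A , B) zero       = A
  select (A , B) (suc zero) = B

  -- The Thue–Morse morphism 0 ↦ 01, 1 ↦ 10 acting on the letters X₀, X₁.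
  μ : M × M → M × M
  μ (A , B) = (B ⊙ A , A ⊙ B)

  select-μ : ∀ X p v → select (μ X) p · v ≡ select X (flipBit p) · (select X p · v)
  select-μ (A , B) zero       v = ·-⊙ B A v
  select-μ (A , B) (suc zero) v = ·-⊙ A B v

  tmProduct : M × M → ℕ → V → V
  tmProduct X zero    v = v
  tmProduct X (suc N) v = select X (tmBit N) · tmProduct X N v

  tmProduct-even : ∀ X N v → tmProduct X (N ℕ.* 2) v ≡ tmProduct (μ X) N v
  tmProduct-even X zero    v = refl
  tmProduct-even X (suc N) v = begin
    select X (tmBit (suc (N ℕ.* 2))) · (select X (tmBit (N ℕ.* 2)) · tmProduct X (N ℕ.* 2) v)
      ≡⟨ cong₂ (λ p q → select X p · (select X q · tmProduct X (N ℕ.* 2) v)) (tmBit-odd N) (tmBit-even N) ⟩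
    select X (flipBit (tmBit N)) · (select X (tmBit N) · tmProduct X (N ℕ.* 2) v)
      ≡⟨ sym (select-μ X (tmBit N) (tmProduct X (N ℕ.* 2) v)) ⟩
    select (μ X) (tmBit N) · tmProduct X (N ℕ.* 2) v
      ≡⟨ cong (select (μ X) (tmBit N) ·_) (tmProduct-even X N v) ⟩
    select (μ X) (tmBit N) · tmProduct (μ X) N v ∎
    where open ≡-Reasoning

  tmProduct-odd : ∀ X N v → tmProduct X (suc (N ℕ.* 2)) v ≡ select X (tmBit N) · tmProduct (μ X) N v
  tmProduct-odd X N v = cong₂ (λ p w → select X p · w) (tmBit-even N) (tmProduct-even X N v)

  module _ {_≈ᴹ_ : Rel M 0ℓ} {_≈ⱽ_ : Rel V 0ℓ} (≈ⱽ-refl : Reflexive _≈ⱽ_)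
           (·-cong : ∀ {A B v w} → A ≈ᴹ B → v ≈ⱽ w → (A · v) ≈ⱽ (B · w)) where

    tmProduct-cong : ∀ {X Y} N v → Pointwise _≈ᴹ_ _≈ᴹ_ X Y → tmProduct X N v ≈ⱽ tmProduct Y N v
    tmProduct-cong zero    v _ = ≈ⱽ-refl
    tmProduct-cong {X} {Y} (suc N) v X≈Y = ·-cong (select-cong (tmBit N)) (tmProduct-cong N v X≈Y)
      where
      select-cong : ∀ p → select X p ≈ᴹ select Y p
      select-cong zero       = proj₁ X≈Y
      select-cong (suc zero) = proj₂ X≈Y

-- 2 × 2 integer matrices, given by their rows

Vec₂ : Set
Vec₂ = ℤ × ℤ

Mat₂ : Set
Mat₂ = Vec₂ × Vec₂

infixr 7 _·_
_·_ : Mat₂ → Vec₂ → Vec₂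
((a , b) , (c , d)) · (x , y) = (a * x + b * y , c * x + d * y)

_⊙_ : Mat₂ → Mat₂ → Mat₂
((a , b) , (c , d)) ⊙ ((e , f) , (g , k)) =
  ((a * e + b * g , a * f + b * k) , (c * e + d * g , c * f + d * k))

row-⊙ : ∀ a b e f g k x y → (a * e + b * g) * x + (a * f + b * k) * y
                            ≡ a * (e * x + f * y) + b * (g * x + k * y)
row-⊙ = solve-∀

·-⊙ : ∀ A B v → (A ⊙ B) · v ≡ A · (B · v)
·-⊙ ((a , b) , (c , d)) ((e , f) , (g , k)) (x , y) =
  cong₂ _,_ (row-⊙ a b e f g k x y) (row-⊙ c d e f g k x y)

open ThueMorseProduct _·_ _⊙_ ·-⊙

hStep : ℤ → Mat₂
hStep z = ((z , + 1) , (+ 1 , + 0))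

hStep-· : ∀ z x y → hStep z · (x , y) ≡ (z * x + y , x)
hStep-· z x y = cong₂ _,_ (cong (λ u → z * x + u) (ℤ.*-identityˡ y))
                          (trans (cong₂ _+_ (ℤ.*-identityˡ x) (ℤ.*-zeroˡ y)) (ℤ.+-identityʳ x))

hPair : Mat₂ × Mat₂
hPair = (hStep (+ 1) , hStep (- + 1))

select-hPair : ∀ n → select hPair (tmBit n) ≡ hStep (t n)
select-hPair n = trans (select-sign (tmBit n)) (cong hStep (sym (t≡sign∘tmBit n)))
  where
  select-sign : ∀ p → select hPair p ≡ hStep (sign p)
  select-sign zero       = refl
  select-sign (suc zero) = refl

-- (h₋₁, h₋₂): the recurrence run backwards from h₁ = 1, h₀ = 0.
hStart : Vec₂
hStart = (+ 1 , - + 1)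

tmProduct-hPair : ∀ n → tmProduct hPair (suc (suc n)) hStart ≡ (h (suc n) , h n)
tmProduct-hPair zero    = refl
tmProduct-hPair (suc n) = begin
  select hPair (tmBit (suc (suc n))) · tmProduct hPair (suc (suc n)) hStart
    ≡⟨ cong₂ _·_ (select-hPair (suc (suc n))) (tmProduct-hPair n) ⟩
  hStep (t (suc (suc n))) · (h (suc n) , h n)
    ≡⟨ hStep-· (t (suc (suc n))) (h (suc n)) (h n) ⟩
  (h (suc (suc n)) , h (suc n)) ∎
  where open ≡-Reasoning

h≡tmProduct : ∀ n → h n ≡ proj₁ (tmProduct hPair (suc n) hStart)
h≡tmProduct zero    = refl
h≡tmProduct (suc n) = sym (cong proj₁ (tmProduct-hPair n))

record FinCoding {A : Set} (_≈_ : Rel A 0ℓ) : Set where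
  field
    size          : ℕ
    encode        : A → Fin size
    decode        : Fin size → A
    decode-encode : ∀ x → decode (encode x) ≈ x

×-coding : {A B : Set} {_≈₁_ : Rel A 0ℓ} {_≈₂_ : Rel B 0ℓ} →
           FinCoding _≈₁_ → FinCoding _≈₂_ → FinCoding (Pointwise _≈₁_ _≈₂_)
×-coding {A} {B} {_≈₁_} {_≈₂_} c₁ c₂ = record
  { size          = C₁.size ℕ.* C₂.size
  ; encode        = encode
  ; decode        = decode
  ; decode-encode = λ (x , y) →
      subst (λ z → Pointwise _≈₁_ _≈₂_ z (x , y))
            (sym (cong (map C₁.decode C₂.decode) (remQuot-combine (C₁.encode x) (C₂.encode y))))
            (C₁.decode-encode x , C₂.decode-encode y)
  }
  where
  module C₁ = FinCoding c₁
  module C₂ = FinCoding c₂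
  encode : A × B → Fin (C₁.size ℕ.* C₂.size)
  encode (x , y) = combine (C₁.encode x) (C₂.encode y)
  decode : Fin (C₁.size ℕ.* C₂.size) → A × B
  decode = map C₁.decode C₂.decode ∘ remQuot C₂.size

-- Congruence modulo m

m∣n∧n<m⇒n≡0 : ∀ {m n} → m ∣ℕ n → n < m → n ≡ 0
m∣n∧n<m⇒n≡0 {n = zero}  _   _   = refl
m∣n∧n<m⇒n≡0 {n = suc _} m∣n n<m = contradiction m∣n (>⇒∤ n<m)

sub-cancel-+ : ∀ r x → (r + x) - r ≡ x
sub-cancel-+ = solve-∀

sub-split : ∀ a b c → a - c ≡ (a - b) + (b - c)
sub-split = solve-∀

sub-neg : ∀ a b → b - a ≡ - (a - b)
sub-neg = solve-∀

sub-+ : ∀ a b c d → (a + c) - (b + d) ≡ (a - b) + (c - d)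
sub-+ = solve-∀

sub-* : ∀ a b c d → a * c - b * d ≡ a * (c - d) + (a - b) * d
sub-* = solve-∀

module Modulo (m : ℕ) .{{_ : NonZero m}} where

  infix 4 _≡ₘ_
  record _≡ₘ_ (a b : ℤ) : Set where
    constructor modEq
    field m∣a-b : + m ∣ a - b

  ≡ₘ-refl : Reflexive _≡ₘ_
  ≡ₘ-refl {a} = modEq (divides (+ 0) (ℤ.+-inverseʳ a))

  ≡ₘ-sym : Symmetric _≡ₘ_
  ≡ₘ-sym {a} {b} (modEq m∣a-b) = modEq (subst (+ m ∣_) (sym (sub-neg a b)) (∣m⇒∣-m m∣a-b))

  ≡ₘ-trans : Transitive _≡ₘ_
  ≡ₘ-trans {a} {b} {c} (modEq m∣a-b) (modEq m∣b-c) =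
    modEq (subst (+ m ∣_) (sym (sub-split a b c)) (∣m∣n⇒∣m+n m∣a-b m∣b-c))

  +-cong : ∀ {a b c d} → a ≡ₘ b → c ≡ₘ d → a + c ≡ₘ b + d
  +-cong {a} {b} {c} {d} (modEq m∣a-b) (modEq m∣c-d) =
    modEq (subst (+ m ∣_) (sym (sub-+ a b c d)) (∣m∣n⇒∣m+n m∣a-b m∣c-d))

  *-cong : ∀ {a b c d} → a ≡ₘ b → c ≡ₘ d → a * c ≡ₘ b * d
  *-cong {a} {b} {c} {d} (modEq m∣a-b) (modEq m∣c-d) =
    modEq (subst (+ m ∣_) (sym (sub-* a b c d)) (∣m∣n⇒∣m+n (∣n⇒∣m*n a m∣c-d) (∣m⇒∣m*n d m∣a-b)))

  ≡ₘ-setoid : Setoid 0ℓ 0ℓ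
  ≡ₘ-setoid = record
    { Carrier = ℤ ; _≈_ = _≡ₘ_
    ; isEquivalence = record
      { refl = ≡ₘ-refl ; sym = ≡ₘ-sym ; trans = ≡ₘ-trans } }

  residue : ℤ → Fin m
  residue a = fromℕ< (n%d<d a (+ m))

  residue≡ₘ : ∀ a → + toℕ (residue a) ≡ₘ a
  residue≡ₘ a = ≡ₘ-sym (modEq (divides q (begin
    a - + toℕ (residue a)  ≡⟨ cong (λ r → a - + r) (toℕ-fromℕ< _) ⟩
    a - r                  ≡⟨ cong (_- r) (a≡a%n+[a/n]*n a (+ m)) ⟩
    (r + q * + m) - r      ≡⟨ sub-cancel-+ r (q * + m) ⟩
    q * + m                ∎)))
    where
    open ≡-Reasoning
    r q : ℤ
    r = + (a ℤ.% + m)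
    q = a ℤ./ + m

  residue-unique : ∀ {r s} → r < m → s < m → + r ≡ₘ + s → r ≡ s
  residue-unique {r} {s} r<m s<m (modEq m∣r-s) =
    ℤ.+-injective (ℤ.i-j≡0⇒i≡j (+ r) (+ s) (ℤ.∣i∣≡0⇒i≡0 (m∣n∧n<m⇒n≡0 (∣⇒∣ᵤ m∣r-s) ∣r-s∣<m)))
    where
    ∣r-s∣<m : ℤ.∣ + r - + s ∣ < m
    ∣r-s∣<m = subst (_< m) (cong ℤ.∣_∣ (sym (ℤ.m-n≡m⊖n r s)))
                    (ℕ.≤-<-trans (ℤ.∣m⊝n∣≤m⊔n r s) (ℕ.⊔-lub r<m s<m))

  residue-cong : ∀ {a b} → a ≡ₘ b → residue a ≡ residue b
  residue-cong {a} {b} a≡b = toℕ-injective (residue-unique (toℕ<n (residue a)) (toℕ<n (residue b))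
    (≡ₘ-trans (residue≡ₘ a) (≡ₘ-trans a≡b (≡ₘ-sym (residue≡ₘ b)))))

  residueCoding : FinCoding _≡ₘ_
  residueCoding = record
    { size = m ; encode = residue ; decode = +_ ∘ toℕ
    ; decode-encode = residue≡ₘ }

  infix 4 _≈ⱽ_ _≈ᴹ_
  _≈ⱽ_ : Rel Vec₂ 0ℓ
  _≈ⱽ_ = Pointwise _≡ₘ_ _≡ₘ_

  _≈ᴹ_ : Rel Mat₂ 0ℓ
  _≈ᴹ_ = Pointwise _≈ⱽ_ _≈ⱽ_

  ≈ⱽ-setoid : Setoid 0ℓ 0ℓ
  ≈ⱽ-setoid = ×-setoid ≡ₘ-setoid ≡ₘ-setoid

  vecCoding : FinCoding _≈ⱽ_
  vecCoding = ×-coding residueCoding residueCoding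

  pairCoding : FinCoding (Pointwise _≈ᴹ_ _≈ᴹ_)
  pairCoding = ×-coding matCoding matCoding
    where
    matCoding : FinCoding _≈ᴹ_
    matCoding = ×-coding vecCoding vecCoding

  ≈ⱽ-refl : Reflexive _≈ⱽ_
  ≈ⱽ-refl = ≡ₘ-refl , ≡ₘ-refl

  ≈ᴹ-refl : Reflexive _≈ᴹ_
  ≈ᴹ-refl = ≈ⱽ-refl , ≈ⱽ-refl

  ·-cong : ∀ {A B v w} → A ≈ᴹ B → v ≈ⱽ w → A · v ≈ⱽ B · w
  ·-cong ((a , b) , (c , d)) (x , y) =
    (+-cong (*-cong a x) (*-cong b y) , +-cong (*-cong c x) (*-cong d y))

  ·-congʳ : ∀ A {v w} → v ≈ⱽ w → A · v ≈ⱽ A · w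
  ·-congʳ A = ·-cong {A} ≈ᴹ-refl

-- Automata from finite invariants

record Recognizer {Δ : Set} (a : ℕ → Δ) : Set₁ where
  field
    State        : Set
    size         : ℕ
    encode       : State → Fin size
    decode       : Fin size → State
    _represents_ : State → ℕ → Set
    start        : State
    step         : State → Fin 2 → State
    output       : State → Δ
    decode-encode-represents : ∀ {s N} → s represents N → decode (encode s) represents N
    start-represents         : start represents 0
    step-represents          : ∀ {s N} b → s represents N → step s b represents pushBit N b
    output-represents        : ∀ {s N} → s represents N → a N ≡ output s

recognizer⇒2-automatic : {Δ : Set} {a : ℕ → Δ} → Recognizer a → Is2Automatic a
recognizer⇒2-automatic {Δ} {a} R = automaton , correct
  where
  open Recognizer R
  automaton : DFAO 2 Δ
  automaton = record
    { nStates = size ; δ = λ q b → encode (step (decode q) b) ; q₀ = encode start ; τ = output ∘ decode }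
  open DFAO automaton using (δ̂)

  run : ∀ w {q N} → decode q represents N → decode (δ̂ q w) represents foldl pushBit N w
  run []      r = r
  run (b ∷ w) r = run w (decode-encode-represents (step-represents b r))

  correct : ∀ n → a n ≡ output (decode (δ̂ (encode start) (base2 n)))
  correct n = output-represents (subst (decode (δ̂ (encode start) (base2 n)) represents_)
                                       (foldl-pushBit-base2 n)
                                       (run (base2 n) (decode-encode-represents start-represents)))

module HModRecognizer (m : ℕ) .{{_ : NonZero m}} where
  open Modulo m
  module P = FinCoding pairCoding
  module W = FinCoding vecCoding

  -- Indexed by all pairs mod m, not only those reachable from hPair, so that it is closed under μ.
  Table : Set
  Table = Fin P.size → Fin W.size

  State : Set
  State = Fin 2 × Table

  lookup : Table → Mat₂ × Mat₂ → Vec₂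
  lookup F X = W.decode (F (P.encode X))

  record _represents_ (s : State) (N : ℕ) : Set where
    constructor _,_
    field
      bit≡   : proj₁ s ≡ tmBit N
      table≈ : ∀ i → W.decode (proj₂ s i) ≈ⱽ tmProduct (P.decode i) N hStart

  lookup-represents : ∀ {s N} → s represents N → ∀ X → lookup (proj₂ s) X ≈ⱽ tmProduct X N hStart
  lookup-represents {_ , F} {N} (_ , F≈) X = begin
    lookup F X                                 ≈⟨ F≈ (P.encode X) ⟩
    tmProduct (P.decode (P.encode X)) N hStart
      ≈⟨ tmProduct-cong {_≈ᴹ_ = _≈ᴹ_} {_≈ⱽ_} ≈ⱽ-refl ·-cong N hStart (P.decode-encode X) ⟩
    tmProduct X N hStart                       ∎
    where open SetoidReasoning ≈ⱽ-setoid

  step : State → Fin 2 → State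
  step (p , F) zero       = (p , λ i → W.encode (lookup F (μ (P.decode i))))
  step (p , F) (suc zero) = (flipBit p , λ i → W.encode (select (P.decode i) p · lookup F (μ (P.decode i))))

  step-represents : ∀ {s N} b → s represents N → step s b represents pushBit N b
  step-represents {p , F} {N} zero r@(refl , _) = sym (tmBit-even N) , λ i → begin
    W.decode (W.encode (lookup F (μ (P.decode i))))  ≈⟨ W.decode-encode (lookup F (μ (P.decode i))) ⟩
    lookup F (μ (P.decode i))                        ≈⟨ lookup-represents r (μ (P.decode i)) ⟩
    tmProduct (μ (P.decode i)) N hStart              ≡⟨ sym (tmProduct-even (P.decode i) N hStart) ⟩
    tmProduct (P.decode i) (N ℕ.* 2) hStart          ∎
    where open SetoidReasoning ≈ⱽ-setoid
  step-represents {p , F} {N} (suc zero) r@(refl , _) = sym (tmBit-odd N) , λ i → begin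
    W.decode (W.encode (select (P.decode i) p · lookup F (μ (P.decode i))))
      ≈⟨ W.decode-encode (select (P.decode i) p · lookup F (μ (P.decode i))) ⟩
    select (P.decode i) p · lookup F (μ (P.decode i))
      ≈⟨ ·-congʳ (select (P.decode i) p) (lookup-represents r (μ (P.decode i))) ⟩
    select (P.decode i) p · tmProduct (μ (P.decode i)) N hStart
      ≡⟨ sym (tmProduct-odd (P.decode i) N hStart) ⟩
    tmProduct (P.decode i) (suc (N ℕ.* 2)) hStart
      ∎
    where open SetoidReasoning ≈ⱽ-setoid

  output : State → Fin m
  output (p , F) = residue (proj₁ (select hPair p · lookup F hPair))

  output-represents : ∀ {s N} → s represents N → hmod m N ≡ output s
  output-represents {p , F} {N} r@(refl , _) = begin
    residue (h N)                                          ≡⟨ cong residue (h≡tmProduct N) ⟩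
    residue (proj₁ (tmProduct hPair (suc N) hStart))       ≡⟨ residue-cong (≡ₘ-sym (proj₁ lastStep)) ⟩
    residue (proj₁ (select hPair p · lookup F hPair))      ∎
    where
    open ≡-Reasoning
    lastStep : select hPair p · lookup F hPair ≈ⱽ tmProduct hPair (suc N) hStart
    lastStep = ·-congʳ (select hPair p) (lookup-represents r hPair)

  encodeState : State → Fin (2 ℕ.* W.size ^ P.size)
  encodeState (p , F) = combine p (funToFin F)

  decodeState : Fin (2 ℕ.* W.size ^ P.size) → State
  decodeState = map id finToFun ∘ remQuot (W.size ^ P.size)

  decode-encode-represents : ∀ {s N} → s represents N → decodeState (encodeState s) represents N
  decode-encode-represents {p , F} {N} (p≡ , F≈) =
    subst (_represents N) (sym (cong (map id finToFun) (remQuot-combine p (funToFin F))))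
          (p≡ , λ i → subst (λ c → W.decode c ≈ⱽ _) (sym (finToFun-funToFin F i)) (F≈ i))

  recognizer : Recognizer (hmod m)
  recognizer = record
    { State = State ; size = 2 ℕ.* W.size ^ P.size ; encode = encodeState ; decode = decodeState
    ; _represents_ = _represents_ ; start = (zero , λ _ → W.encode hStart) ; step = step ; output = output
    ; decode-encode-represents = decode-encode-represents
    ; start-represents         = refl , λ _ → W.decode-encode hStart
    ; step-represents          = step-represents
    ; output-represents        = output-represents
    }

theorem1 : (m : ℕ) → .{{_ : NonZero m}} → m ≥ 2 → Is2Automatic (hmod m)
theorem1 m _ = recognizer⇒2-automatic (HModRecognizer.recognizer m)
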